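{- If $T\in\mathscr{O}$, then $\gamma(T)=\gamma_{t2}(T)$.
   Context: All trees considered have at least two vertices. $\gamma(G)$ is the domination number of $G$ (minimum size of a set $S$ such that every vertex outside $S$ has a neighbor in $S$). A set $D\subseteq V(G)$ is a semitotal dominating set if it is dominating and every vertex of $D$ is at distance at most $2$ from some other vertex of $D$; $\gamma_{t2}(G)$ is the minimum cardinality of such a set, and a $\gamma_{t2}(G)$-set is one of that cardinality. An almost dominating set of $G$ relative to a vertex $v$ is a set dominating all vertices of $G$ except possibly $v$; $\gamma(G;v)$ is the minimum cardinality of such a set. $P_k$ denotes the path on $k$ vertices. For $t\ge 2$, a subdivided star $X$ with $t$ leaves is obtained from the star $K_{1,t}$ with center $x$ by subdividing every edge once. $Y$ with three leaves denotes the tree obtained from the star $K_{1,3}$ with center $x$ by subdividing exactly one edge once (so $x$ has two leaf-neighbors). The operations on a tree $T$ are: $\mathscr{O}_1$: add a new vertex and join it to a vertex of $T$ that lies in some $\gamma_{t2}(T)$-set. $\mathscr{O}_2$: add a new path $P_2$ or $P_5$ and join one of its leaves (end vertices) to a vertex $v$ of $T$ with $\gamma(T;v)=\gamma(T)$. $\mathscr{O}_3$: add a subdivided star $X$ with at least two leaves and join its center $x$ to a vertex of $T$. $\mathscr{O}_4$: add a copy of $Y$ with three leaves and join a leaf-neighbor of its center $x$ to a vertex of $T$. $\mathscr{O}$ is the family of trees obtained from $P_4$ by a finite sequence (possibly empty) of these operations. -}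

module Defs where

open import Data.Nat using (ℕ; zero; suc; _+_; _≤_)
open import Data.Fin using (Fin; zero; suc; _↑ˡ_; _↑ʳ_)
open import Data.Fin.Subset using (Subset; _∈_; ∣_∣)
open import Data.List using (List; []; _∷_; map; _++_; concatMap; allFin)
import Data.List.Membership.Propositional as L
open import Data.Product using (Σ; ∃; ∃-syntax; _×_; _,_)
open import Data.Sum using (_⊎_)
open import Relation.Binary.PropositionalEquality using (_≡_)
open import Relation.Nullary using (¬_)

-- A (simple, undirected) graph on vertex set Fin n, given by an edge list.
record Graph (n : ℕ) : Set where
  constructor graph
  field edges : List (Fin n × Fin n)
open Graph public

Adj : ∀ {n} → Graph n → Fin n → Fin n → Set
Adj G u v = (u , v) L.∈ edges G ⊎ (v , u) L.∈ edges G

Dominating : ∀ {n} → Graph n → Subset n → Set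
Dominating G S = ∀ v → v ∈ S ⊎ (∃[ u ] (u ∈ S × Adj G u v))

AlmostDominating : ∀ {n} → Graph n → Fin n → Subset n → Set
AlmostDominating G w S = ∀ v → ¬ (v ≡ w) → v ∈ S ⊎ (∃[ u ] (u ∈ S × Adj G u v))

Dist≤2 : ∀ {n} → Graph n → Fin n → Fin n → Set
Dist≤2 G u w = u ≡ w ⊎ Adj G u w ⊎ (∃[ z ] (Adj G u z × Adj G z w))

SemitotalDominating : ∀ {n} → Graph n → Subset n → Set
SemitotalDominating G S =
  Dominating G S × (∀ u → u ∈ S → ∃[ w ] (w ∈ S × ¬ (u ≡ w) × Dist≤2 G u w))

IsMinCard : ∀ {n} → (Subset n → Set) → ℕ → Set
IsMinCard {n} P k = (∃[ S ] (P S × ∣ S ∣ ≡ k)) × (∀ S → P S → k ≤ ∣ S ∣)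

IsDomNum : ∀ {n} → Graph n → ℕ → Set
IsDomNum G = IsMinCard (Dominating G)

IsSemitotalDomNum : ∀ {n} → Graph n → ℕ → Set
IsSemitotalDomNum G = IsMinCard (SemitotalDominating G)

IsAlmostDomNum : ∀ {n} → Graph n → Fin n → ℕ → Set
IsAlmostDomNum G v = IsMinCard (AlmostDominating G v)

IsSemitotalDomSet : ∀ {n} → Graph n → Subset n → Set
IsSemitotalDomSet G S = SemitotalDominating G S × IsSemitotalDomNum G ∣ S ∣

join : ∀ {n m} → Graph n → Graph m → Fin n → Fin m → Graph (n + m)
join {n} {m} G H v a = graph
  (map (λ { (x , y) → x ↑ˡ m , y ↑ˡ m }) (edges G)
   ++ map (λ { (x , y) → n ↑ʳ x , n ↑ʳ y }) (edges H)
   ++ ((v ↑ˡ m , n ↑ʳ a) ∷ []))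

K1 : Graph 1
K1 = graph []

-- paths (vertex 0 is an end vertex)
P2 : Graph 2
P2 = graph ((zero , suc zero) ∷ [])

P4 : Graph 4
P4 = graph ((0F , 1F) ∷ (1F , 2F) ∷ (2F , 3F) ∷ [])
  where
  0F 1F 2F 3F : Fin 4
  0F = zero
  1F = suc zero
  2F = suc (suc zero)
  3F = suc (suc (suc zero))

P5 : Graph 5
P5 = graph ((0F , 1F) ∷ (1F , 2F) ∷ (2F , 3F) ∷ (3F , 4F) ∷ [])
  where
  0F 1F 2F 3F 4F : Fin 5
  0F = zero
  1F = suc zero
  2F = suc (suc zero)
  3F = suc (suc (suc zero))
  4F = suc (suc (suc (suc zero)))

-- subdivided star with t leaves: center = zero, subdivision vertices
-- suc (i ↑ˡ t), leaves suc (t ↑ʳ i), for i : Fin t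
SubdividedStar : (t : ℕ) → Graph (suc (t + t))
SubdividedStar t = graph (concatMap
  (λ i → (zero , suc (i ↑ˡ t)) ∷ (suc (i ↑ˡ t) , suc (t ↑ʳ i)) ∷ [])
  (allFin t))

-- Y: center x = 0 with leaf neighbours 1 and 2; the edge x–4 is subdivided by 3
Y : Graph 5
Y = graph ((0F , 1F) ∷ (0F , 2F) ∷ (0F , 3F) ∷ (3F , 4F) ∷ [])
  where
  0F 1F 2F 3F 4F : Fin 5
  0F = zero
  1F = suc zero
  2F = suc (suc zero)
  3F = suc (suc (suc zero))
  4F = suc (suc (suc (suc zero)))

yLeafNbr : Fin 5
yLeafNbr = suc zero

data InO : ∀ {n} → Graph n → Set where
  base : InO P4
  op1 : ∀ {n} {T : Graph n} → InO T → (v : Fin n) →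
        (∃[ S ] (IsSemitotalDomSet T S × v ∈ S)) →
        InO (join T K1 v zero)
  op2-P2 : ∀ {n} {T : Graph n} → InO T → (v : Fin n) →
           (∃[ k ] (IsDomNum T k × IsAlmostDomNum T v k)) →
           InO (join T P2 v zero)
  op2-P5 : ∀ {n} {T : Graph n} → InO T → (v : Fin n) →
           (∃[ k ] (IsDomNum T k × IsAlmostDomNum T v k)) →
           InO (join T P5 v zero)
  op3 : ∀ {n} {T : Graph n} → InO T → (v : Fin n) → (t : ℕ) → 2 ≤ t →
        InO (join T (SubdividedStar t) v zero)
  op4 : ∀ {n} {T : Graph n} → InO T → (v : Fin n) →
        InO (join T Y v yLeafNbr)

-- We prove the stronger invariant "T is tight at k": some semitotal
-- dominating set has k vertices and no dominating set has fewer.  Since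
-- semitotal dominating sets dominate, tightness at k gives γ = γ_t2 = k.
--
-- P4 is tight at 2, and each operation attaches a gadget H to T by one edge
-- v–a.  The gluing theorem (module Join) says: if T is tight at k, then the
-- join is tight at k + c provided
--   * H has a core of c vertices which, together with a semitotal set of T,
--     dominates H and gives each core vertex other than a a partner, and
--   * (kind A) every set dominating H except possibly a has at least c
--     vertices, and c + 1 if it contains a; or
--     (kind B) such sets have at least c vertices and γ(T;v) = γ(T).
-- Kind A covers the pendant vertex (𝒪₁), subdivided stars (𝒪₃) and Y (𝒪₄);
-- kind B covers the pendant paths P2, P5 (𝒪₂).  The lower bounds for the
-- gadgets come from a packing argument: a set meeting pairwise disjoint
-- closed neighbourhoods has at least as many vertices as there are
-- neighbourhoods.
module Submission where

open import Defs
open import Data.Nat using (ℕ; zero; suc; _+_; _≤_; s≤s; z≤n)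
open import Data.Nat.Properties
  using (≤-trans; ≤-antisym; +-suc; +-assoc; +-identityʳ; +-mono-≤; +-monoˡ-≤; +-monoʳ-≤; module ≤-Reasoning)
open import Data.Fin using (Fin; zero; suc; _↑ˡ_; _↑ʳ_)
open import Data.Fin.Properties using (_≟_; ↑ˡ-injective; ↑ʳ-injective; suc-injective)
open import Data.Fin.Subset using (Subset; _∈_; _⊆_; ∣_∣; inside; outside; _-_; _∪_; ⁅_⁆; ⊤; ⊥)
open import Data.Fin.Subset.Properties
  using (_∈?_; ∣p∣≤∣x∷p∣; ∣⊤∣≡n; ∣⊥∣≡0; ∈⊤; ∉⊥; x∈⁅x⁆; ∣⁅x⁆∣≡1; p⊆p∪q; q⊆p∪q;
         p⊆q⇒∣p∣≤∣q∣; x∈p⇒∣p-x∣<∣p∣; x∈p∧x≢y⇒x∈p-y)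
open import Data.Vec using ([]; _∷_; _++_; here; there; splitAt)
open import Data.List as List using (List; []; _∷_; [_]; length; concatMap; allFin)
open import Data.List.Relation.Unary.All using (All; []; _∷_; all?)
import Data.List.Relation.Unary.All as All
open import Data.List.Relation.Unary.Any using (Any; here; there)
open import Data.List.Relation.Unary.AllPairs using (AllPairs; []; _∷_; allPairs?)
open import Data.List.Membership.Propositional using (find; lose) renaming (_∈_ to _∈ₗ_)
open import Data.List.Membership.Propositional.Properties
  using (∈-map⁺; ∈-map⁻; ∈-++⁺ˡ; ∈-++⁺ʳ; ∈-++⁻; ∈-concatMap⁺; ∈-concatMap⁻; ∈-allFin)
open import Data.Product using (∃-syntax; _×_; _,_; proj₁; proj₂)
open import Data.Sum using (_⊎_; inj₁; inj₂; swap; [_,_]′)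
open import Data.Empty using (⊥-elim)
open import Relation.Nullary using (¬_; Dec; yes; no; ¬?)
open import Relation.Nullary.Decidable using (True; toWitness)
open import Relation.Binary.PropositionalEquality using (_≡_; _≢_; refl; sym; trans; cong; subst)

DominatedBy : ∀ {n} → Graph n → Subset n → Fin n → Set
DominatedBy G S x = x ∈ S ⊎ ∃[ u ] (u ∈ S × Adj G u x)

HasPartner : ∀ {n} → Graph n → Subset n → Fin n → Set
HasPartner G S x = ∃[ w ] (w ∈ S × ¬ (x ≡ w) × Dist≤2 G x w)

SemitotalOfSize : ∀ {n} → Graph n → ℕ → Set
SemitotalOfSize G k = ∃[ S ] (SemitotalDominating G S × ∣ S ∣ ≡ k)

DomLowerBound : ∀ {n} → Graph n → ℕ → Set
DomLowerBound G k = ∀ D → Dominating G D → k ≤ ∣ D ∣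

Tight : ∀ {n} → Graph n → ℕ → Set
Tight G k = SemitotalOfSize G k × DomLowerBound G k

tight⇒γ≡γt2 : ∀ {n} {G : Graph n} {k} → Tight G k → IsDomNum G k × IsSemitotalDomNum G k
tight⇒γ≡γt2 ((S , semi , size) , bound) =
  ((S , proj₁ semi , size) , bound) , ((S , semi , size) , λ D semiD → bound D (proj₁ semiD))

γt2-set-size : ∀ {n} {G : Graph n} {k S} → Tight G k → IsSemitotalDomSet G S → ∣ S ∣ ≡ k
γt2-set-size ((S₀ , semi₀ , size₀) , bound) (semi , _ , minimal) =
  ≤-antisym (subst (_ ≤_) size₀ (minimal S₀ semi₀)) (bound _ (proj₁ semi))

almost-bound : ∀ {n} {G : Graph n} {k v} → Tight G k →
  (∃[ k' ] (IsDomNum G k' × IsAlmostDomNum G v k')) →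
  ∀ D → AlmostDominating G v D → k ≤ ∣ D ∣
almost-bound ((S₀ , semi₀ , size₀) , bound) (k' , ((D' , dom' , size') , minimal) , (_ , almostMinimal)) D almost =
  subst (_≤ ∣ D ∣) k'≡k (almostMinimal D almost)
  where
  k'≡k : k' ≡ _
  k'≡k = ≤-antisym (subst (k' ≤_) size₀ (minimal S₀ (proj₁ semi₀))) (subst (_ ≤_) size' (bound D' dom'))

module Transport {n n'} {G : Graph n} {G' : Graph n'} (f : Fin n → Fin n')
  (hom : ∀ {x y} → Adj G x y → Adj G' (f x) (f y)) {S : Subset n} {S' : Subset n'}
  (mem : ∀ {x} → x ∈ S → f x ∈ S') where

  dominated-map : ∀ {x} → DominatedBy G S x → DominatedBy G' S' (f x)
  dominated-map (inj₁ x∈S) = inj₁ (mem x∈S)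
  dominated-map (inj₂ (u , u∈S , adj)) = inj₂ (f u , mem u∈S , hom adj)

  dist-map : ∀ {x w} → Dist≤2 G x w → Dist≤2 G' (f x) (f w)
  dist-map (inj₁ refl) = inj₁ refl
  dist-map (inj₂ (inj₁ adj)) = inj₂ (inj₁ (hom adj))
  dist-map (inj₂ (inj₂ (z , adj₁ , adj₂))) = inj₂ (inj₂ (f z , hom adj₁ , hom adj₂))

  partner-map : (∀ {x y} → f x ≡ f y → x ≡ y) → ∀ {x} → HasPartner G S x → HasPartner G' S' (f x)
  partner-map inj (w , w∈S , x≢w , d) = f w , mem w∈S , (λ e → x≢w (inj e)) , dist-map d

dominated-mono : ∀ {n} {G : Graph n} {S S' : Subset n} → S ⊆ S' → ∀ {x} → DominatedBy G S x → DominatedBy G S' x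
dominated-mono S⊆S' = Transport.dominated-map (λ x → x) (λ adj → adj) S⊆S'

data Side (n m : ℕ) : Fin (n + m) → Set where
  left  : (x : Fin n) → Side n m (x ↑ˡ m)
  right : (y : Fin m) → Side n m (n ↑ʳ y)

side : ∀ n m (z : Fin (n + m)) → Side n m z
side zero m z = right z
side (suc n) m zero = left zero
side (suc n) m (suc z) with side n m z
... | left x = left (suc x)
... | right y = right y

↑ˡ≢↑ʳ : ∀ {n m} (x : Fin n) (y : Fin m) → x ↑ˡ m ≢ n ↑ʳ y
↑ˡ≢↑ʳ {suc n} zero y ()
↑ˡ≢↑ʳ {suc n} (suc x) y eq = ↑ˡ≢↑ʳ x y (suc-injective eq)

data Split (n m : ℕ) : Subset (n + m) → Set where
  _⊕_ : (p : Subset n) (q : Subset m) → Split n m (p ++ q)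

split : ∀ n m (s : Subset (n + m)) → Split n m s
split n m s with splitAt n s
... | p , q , refl = p ⊕ q

∈ˡ⁺ : ∀ {n m} {p : Subset n} {q : Subset m} {x} → x ∈ p → x ↑ˡ m ∈ p ++ q
∈ˡ⁺ here = here
∈ˡ⁺ (there x∈p) = there (∈ˡ⁺ x∈p)

∈ˡ⁻ : ∀ {n m} (p : Subset n) {q : Subset m} x → x ↑ˡ m ∈ p ++ q → x ∈ p
∈ˡ⁻ (_ ∷ p) zero here = here
∈ˡ⁻ (_ ∷ p) (suc x) (there x∈) = there (∈ˡ⁻ p x x∈)

∈ʳ⁺ : ∀ {n m} (p : Subset n) {q : Subset m} {y} → y ∈ q → n ↑ʳ y ∈ p ++ q
∈ʳ⁺ [] y∈q = y∈q
∈ʳ⁺ (_ ∷ p) y∈q = there (∈ʳ⁺ p y∈q)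

∈ʳ⁻ : ∀ {n m} (p : Subset n) {q : Subset m} y → n ↑ʳ y ∈ p ++ q → y ∈ q
∈ʳ⁻ [] y y∈ = y∈
∈ʳ⁻ (_ ∷ p) y (there y∈) = ∈ʳ⁻ p y y∈

∣p++q∣ : ∀ {n m} (p : Subset n) (q : Subset m) → ∣ p ++ q ∣ ≡ ∣ p ∣ + ∣ q ∣
∣p++q∣ [] q = refl
∣p++q∣ (inside ∷ p) q = cong suc (∣p++q∣ p q)
∣p++q∣ (outside ∷ p) q = ∣p++q∣ p q

∣p∪q∣≤∣p∣+∣q∣ : ∀ {n} (p q : Subset n) → ∣ p ∪ q ∣ ≤ ∣ p ∣ + ∣ q ∣
∣p∪q∣≤∣p∣+∣q∣ [] [] = z≤n
∣p∪q∣≤∣p∣+∣q∣ (inside ∷ p) (b ∷ q) =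
  s≤s (≤-trans (∣p∪q∣≤∣p∣+∣q∣ p q) (+-monoʳ-≤ ∣ p ∣ (∣p∣≤∣x∷p∣ b q)))
∣p∪q∣≤∣p∣+∣q∣ (outside ∷ p) (inside ∷ q) =
  subst (suc ∣ p ∪ q ∣ ≤_) (sym (+-suc ∣ p ∣ ∣ q ∣)) (s≤s (∣p∪q∣≤∣p∣+∣q∣ p q))
∣p∪q∣≤∣p∣+∣q∣ (outside ∷ p) (outside ∷ q) = ∣p∪q∣≤∣p∣+∣q∣ p q

covering-bound : ∀ {t} (p q : Subset t) → (∀ i → i ∈ p ⊎ i ∈ q) → t ≤ ∣ p ∣ + ∣ q ∣
covering-bound {t} p q cover = begin
  t              ≡⟨ sym (∣⊤∣≡n t) ⟩
  ∣ ⊤ {t} ∣      ≤⟨ p⊆q⇒∣p∣≤∣q∣ {p = ⊤} (λ {i} _ → [ p⊆p∪q q , q⊆p∪q p q ]′ (cover i)) ⟩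
  ∣ p ∪ q ∣      ≤⟨ ∣p∪q∣≤∣p∣+∣q∣ p q ⟩
  ∣ p ∣ + ∣ q ∣  ∎
  where
  open ≤-Reasoning

-- Lists of vertices with no vertex in common; decidable, so concrete
-- instances are checked by computation.
Apart : ∀ {n} → List (Fin n) → List (Fin n) → Set
Apart xs ys = All (λ x → All (x ≢_) ys) xs

apart? : ∀ {n} (xs ys : List (Fin n)) → Dec (Apart xs ys)
apart? xs ys = all? (λ x → all? (λ y → ¬? (x ≟ y)) ys) xs

apart-by-computation : ∀ {n} (xss : List (List (Fin n))) → {True (allPairs? apart? xss)} → AllPairs Apart xss
apart-by-computation xss {ok} = toWitness ok

packing : ∀ {n} (D : Subset n) (xss : List (List (Fin n))) →
  AllPairs Apart xss → All (Any (_∈ D)) xss → length xss ≤ ∣ D ∣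
packing D [] [] [] = z≤n
packing D (xs ∷ xss) (apart ∷ apartRest) (meets ∷ meetsRest) with find meets
... | x , x∈xs , x∈D =
  ≤-trans (s≤s (packing (D - x) xss apartRest (avoidAll apart meetsRest))) (x∈p⇒∣p-x∣<∣p∣ x∈D)
  where
  avoid : ∀ {ys} → All (x ≢_) ys → Any (_∈ D) ys → Any (_∈ D - x) ys
  avoid (x≢y ∷ _) (here y∈D) = here (x∈p∧x≢y⇒x∈p-y y∈D (λ e → x≢y (sym e)))
  avoid (_ ∷ x≢ys) (there meets') = there (avoid x≢ys meets')

  avoidAll : ∀ {yss} → All (Apart xs) yss → All (Any (_∈ D)) yss → All (Any (_∈ D - x)) yss
  avoidAll [] [] = []
  avoidAll (a ∷ as) (m ∷ ms) = avoid (All.lookup a x∈xs) m ∷ avoidAll as ms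

-- Neighbours of x, read off the edge list by decidable equality, so that for
-- a concrete graph closedNbhd G x computes to a literal list.
keepIf : ∀ {P : Set} {A : Set} → Dec P → A → List A
keepIf (yes _) a = [ a ]
keepIf (no _) a = []

keepIf-yes : ∀ {P : Set} {A : Set} (d : Dec P) {a : A} → P → a ∈ₗ keepIf d a
keepIf-yes (yes _) _ = here refl
keepIf-yes (no ¬p) p = ⊥-elim (¬p p)

endsAt : ∀ {n} → Fin n → Fin n × Fin n → List (Fin n)
endsAt x (u , w) = keepIf (w ≟ x) u List.++ keepIf (u ≟ x) w

neighbours : ∀ {n} → Graph n → Fin n → List (Fin n)
neighbours G x = concatMap (endsAt x) (edges G)

closedNbhd : ∀ {n} → Graph n → Fin n → List (Fin n)
closedNbhd G x = x ∷ neighbours G x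

adj⇒neighbour : ∀ {n} {G : Graph n} {u x} → Adj G u x → u ∈ₗ neighbours G x
adj⇒neighbour {x = x} (inj₁ e) = ∈-concatMap⁺ (endsAt x) (lose e (∈-++⁺ˡ (keepIf-yes (x ≟ x) refl)))
adj⇒neighbour {x = x} (inj₂ e) = ∈-concatMap⁺ (endsAt x) (lose e (∈-++⁺ʳ _ (keepIf-yes (x ≟ x) refl)))

dominated⇒meets : ∀ {n} {G : Graph n} {D x} → DominatedBy G D x → Any (_∈ D) (closedNbhd G x)
dominated⇒meets (inj₁ x∈D) = here x∈D
dominated⇒meets (inj₂ (u , u∈D , adj)) = there (lose (adj⇒neighbour adj) u∈D)

AttachmentCost : ∀ {m} → Graph m → Fin m → ℕ → Set
AttachmentCost H a c = ∀ q → AlmostDominating H a q → c ≤ ∣ q ∣ × (a ∈ q → suc c ≤ ∣ q ∣)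

AlmostDomBound : ∀ {m} → Graph m → Fin m → ℕ → Set
AlmostDomBound H a c = ∀ q → AlmostDominating H a q → c ≤ ∣ q ∣

module Join {n m} (G : Graph n) (H : Graph m) (v : Fin n) (a : Fin m) where

  JG : Graph (n + m)
  JG = join G H v a

  data JoinAdj : Fin (n + m) → Fin (n + m) → Set where
    inG : ∀ {x y} → Adj G x y → JoinAdj (x ↑ˡ m) (y ↑ˡ m)
    inH : ∀ {x y} → Adj H x y → JoinAdj (n ↑ʳ x) (n ↑ʳ y)
    bridge : JoinAdj (v ↑ˡ m) (n ↑ʳ a)
    bridge˘ : JoinAdj (n ↑ʳ a) (v ↑ˡ m)

  flip : ∀ {z w} → JoinAdj z w → JoinAdj w z
  flip (inG adj) = inG (swap adj)
  flip (inH adj) = inH (swap adj)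
  flip bridge = bridge˘
  flip bridge˘ = bridge

  joinAdj⁺ : ∀ {z w} → JoinAdj z w → Adj JG z w
  joinAdj⁺ (inG (inj₁ e)) = inj₁ (∈-++⁺ˡ (∈-map⁺ _ e))
  joinAdj⁺ (inG (inj₂ e)) = inj₂ (∈-++⁺ˡ (∈-map⁺ _ e))
  joinAdj⁺ (inH (inj₁ e)) = inj₁ (∈-++⁺ʳ (List.map _ (edges G)) (∈-++⁺ˡ (∈-map⁺ _ e)))
  joinAdj⁺ (inH (inj₂ e)) = inj₂ (∈-++⁺ʳ (List.map _ (edges G)) (∈-++⁺ˡ (∈-map⁺ _ e)))
  joinAdj⁺ bridge = inj₁ (∈-++⁺ʳ (List.map _ (edges G)) (∈-++⁺ʳ (List.map _ (edges H)) (here refl)))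
  joinAdj⁺ bridge˘ = inj₂ (∈-++⁺ʳ (List.map _ (edges G)) (∈-++⁺ʳ (List.map _ (edges H)) (here refl)))

  edge⁻ : ∀ {z w} → (z , w) ∈ₗ edges JG → JoinAdj z w
  edge⁻ e with ∈-++⁻ (List.map _ (edges G)) e
  ... | inj₁ eG with ∈-map⁻ _ eG
  ...   | (x , y) , e' , refl = inG (inj₁ e')
  edge⁻ e | inj₂ e' with ∈-++⁻ (List.map _ (edges H)) e'
  ... | inj₁ eH with ∈-map⁻ _ eH
  ...   | (x , y) , e'' , refl = inH (inj₁ e'')
  edge⁻ e | inj₂ e' | inj₂ (here refl) = bridge

  joinAdj⁻ : ∀ {z w} → Adj JG z w → JoinAdj z w
  joinAdj⁻ (inj₁ e) = edge⁻ e
  joinAdj⁻ (inj₂ e) = flip (edge⁻ e)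

  nbrˡ : ∀ {u x} → Adj JG u (x ↑ˡ m) → (∃[ x' ] (u ≡ x' ↑ˡ m × Adj G x' x)) ⊎ (u ≡ n ↑ʳ a × x ≡ v)
  nbrˡ {x = x} adj = classify (joinAdj⁻ adj) refl
    where
    classify : ∀ {u w} → JoinAdj u w → w ≡ x ↑ˡ m → (∃[ x' ] (u ≡ x' ↑ˡ m × Adj G x' x)) ⊎ (u ≡ n ↑ʳ a × x ≡ v)
    classify (inG {x'} {y} adj') eq = inj₁ (x' , refl , subst (Adj G x') (↑ˡ-injective m y x eq) adj')
    classify (inH {y = y} _) eq = ⊥-elim (↑ˡ≢↑ʳ x y (sym eq))
    classify bridge eq = ⊥-elim (↑ˡ≢↑ʳ x a (sym eq))
    classify bridge˘ eq = inj₂ (refl , sym (↑ˡ-injective m v x eq))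

  nbrʳ : ∀ {u y} → Adj JG u (n ↑ʳ y) → (∃[ y' ] (u ≡ n ↑ʳ y' × Adj H y' y)) ⊎ (u ≡ v ↑ˡ m × y ≡ a)
  nbrʳ {y = y} adj = classify (joinAdj⁻ adj) refl
    where
    classify : ∀ {u w} → JoinAdj u w → w ≡ n ↑ʳ y → (∃[ y' ] (u ≡ n ↑ʳ y' × Adj H y' y)) ⊎ (u ≡ v ↑ˡ m × y ≡ a)
    classify (inG {y = x} _) eq = ⊥-elim (↑ˡ≢↑ʳ x y eq)
    classify (inH {y'} {y''} adj') eq = inj₁ (y' , refl , subst (Adj H y') (↑ʳ-injective n y'' y eq) adj')
    classify bridge eq = inj₂ (refl , sym (↑ʳ-injective n a y eq))
    classify bridge˘ eq = ⊥-elim (↑ˡ≢↑ʳ v y eq)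

  restrictˡ : ∀ p q → Dominating JG (p ++ q) → ∀ x → DominatedBy G p x ⊎ (x ≡ v × a ∈ q)
  restrictˡ p q dom x with dom (x ↑ˡ m)
  ... | inj₁ x∈ = inj₁ (inj₁ (∈ˡ⁻ p x x∈))
  ... | inj₂ (u , u∈ , adj) with nbrˡ adj
  ...   | inj₁ (x' , refl , adjG) = inj₁ (inj₂ (x' , ∈ˡ⁻ p x' u∈ , adjG))
  ...   | inj₂ (refl , x≡v) = inj₂ (x≡v , ∈ʳ⁻ p a u∈)

  restrictʳ : ∀ p q → Dominating JG (p ++ q) → AlmostDominating H a q
  restrictʳ p q dom y y≢a with dom (n ↑ʳ y)
  ... | inj₁ y∈ = inj₁ (∈ʳ⁻ p y y∈)
  ... | inj₂ (u , u∈ , adj) with nbrʳ adj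
  ...   | inj₁ (y' , refl , adjH) = inj₂ (y' , ∈ʳ⁻ p y' u∈ , adjH)
  ...   | inj₂ (_ , y≡a) = ⊥-elim (y≢a y≡a)

  record Core (p : Subset n) (c : ℕ) : Set where
    field
      set : Subset m
      size : ∣ set ∣ ≡ c
      dominates : ∀ y → DominatedBy H set y ⊎ (y ≡ a × v ∈ p)
      partnered : ∀ y → y ∈ set → HasPartner H set y ⊎ y ≡ a

  upper : ∀ {k c} (W : SemitotalOfSize G k) → Core (proj₁ W) c → SemitotalOfSize JG (k + c)
  upper {k} (S , (domS , partS) , sizeS) core = S ++ set , (dom , part) , size'
    where
    open Core core
    module L = Transport (_↑ˡ m) (λ adj → joinAdj⁺ (inG adj)) {S} {S ++ set} ∈ˡ⁺
    module R = Transport (n ↑ʳ_) (λ adj → joinAdj⁺ (inH adj)) {set} {S ++ set} (∈ʳ⁺ S)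

    dom : Dominating JG (S ++ set)
    dom z with side n m z
    ... | left x = L.dominated-map (domS x)
    ... | right y with dominates y
    ...   | inj₁ d = R.dominated-map d
    ...   | inj₂ (refl , v∈S) = inj₂ (v ↑ˡ m , ∈ˡ⁺ v∈S , joinAdj⁺ bridge)

    -- a's partner is v itself or v's dominator in S
    partner-of-a : HasPartner JG (S ++ set) (n ↑ʳ a)
    partner-of-a with domS v
    ... | inj₁ v∈S = v ↑ˡ m , ∈ˡ⁺ v∈S , (λ e → ↑ˡ≢↑ʳ v a (sym e)) , inj₂ (inj₁ (joinAdj⁺ bridge˘))
    ... | inj₂ (u , u∈S , adj) =
      u ↑ˡ m , ∈ˡ⁺ u∈S , (λ e → ↑ˡ≢↑ʳ u a (sym e)) ,
      inj₂ (inj₂ (v ↑ˡ m , joinAdj⁺ bridge˘ , joinAdj⁺ (inG (swap adj))))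

    part : ∀ z → z ∈ S ++ set → HasPartner JG (S ++ set) z
    part z z∈ with side n m z
    ... | left x = L.partner-map (↑ˡ-injective m _ _) (partS x (∈ˡ⁻ S x z∈))
    ... | right y with partnered y (∈ʳ⁻ S y z∈)
    ...   | inj₁ partner = R.partner-map (↑ʳ-injective n _ _) partner
    ...   | inj₂ refl = partner-of-a

    size' : ∣ S ++ set ∣ ≡ k + _
    size' = trans (∣p++q∣ S set) (trans (cong (_+ ∣ set ∣) sizeS) (cong (k +_) size))

  lowerᴬ : ∀ {k c} → DomLowerBound G k → AttachmentCost H a c → DomLowerBound JG (k + c)
  lowerᴬ {k} {c} boundG cost D dom with split n m D
  ... | p ⊕ q = subst (k + c ≤_) (sym (∣p++q∣ p q)) (by-cases (a ∈? q))
    where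
    restricted = restrictˡ p q dom
    cost-q = cost q (restrictʳ p q dom)

    by-cases : Dec (a ∈ q) → k + c ≤ ∣ p ∣ + ∣ q ∣
    by-cases (no a∉q) = +-mono-≤ (boundG p domP) (proj₁ cost-q)
      where
      domP : Dominating G p
      domP x with restricted x
      ... | inj₁ d = d
      ... | inj₂ (_ , a∈q) = ⊥-elim (a∉q a∈q)
    by-cases (yes a∈q) = begin
      k + c                  ≤⟨ +-monoˡ-≤ c (boundG (p ∪ ⁅ v ⁆) domPv) ⟩
      ∣ p ∪ ⁅ v ⁆ ∣ + c      ≤⟨ +-monoˡ-≤ c (∣p∪q∣≤∣p∣+∣q∣ p ⁅ v ⁆) ⟩
      ∣ p ∣ + ∣ ⁅ v ⁆ ∣ + c  ≡⟨ cong (λ s → ∣ p ∣ + s + c) (∣⁅x⁆∣≡1 v) ⟩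
      ∣ p ∣ + 1 + c          ≡⟨ +-assoc ∣ p ∣ 1 c ⟩
      ∣ p ∣ + suc c          ≤⟨ +-monoʳ-≤ ∣ p ∣ (proj₂ cost-q a∈q) ⟩
      ∣ p ∣ + ∣ q ∣          ∎
      where
      open ≤-Reasoning
      domPv : Dominating G (p ∪ ⁅ v ⁆)
      domPv x with restricted x
      ... | inj₁ d = dominated-mono (p⊆p∪q ⁅ v ⁆) d
      ... | inj₂ (refl , _) = inj₁ (q⊆p∪q p ⁅ v ⁆ (x∈⁅x⁆ v))

  lowerᴮ : ∀ {k c} → (∀ D → AlmostDominating G v D → k ≤ ∣ D ∣) → AlmostDomBound H a c → DomLowerBound JG (k + c)
  lowerᴮ {k} {c} boundG boundH D dom with split n m D
  ... | p ⊕ q = subst (k + c ≤_) (sym (∣p++q∣ p q)) (+-mono-≤ (boundG p almostP) (boundH q (restrictʳ p q dom)))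
    where
    almostP : AlmostDominating G v p
    almostP x x≢v with restrictˡ p q dom x
    ... | inj₁ d = d
    ... | inj₂ (x≡v , _) = ⊥-elim (x≢v x≡v)

pattern 0F = zero
pattern 1F = suc zero
pattern 2F = suc (suc zero)
pattern 3F = suc (suc (suc zero))
pattern 4F = suc (suc (suc (suc zero)))

-- The base tree P4 is tight at 2: {1, 2} is semitotal, and every dominating
-- set meets the disjoint closed neighbourhoods of the two ends.
tight-P4 : Tight P4 2
tight-P4 = (S , (dom , part) , refl) , bound
  where
  S : Subset 4
  S = outside ∷ inside ∷ inside ∷ outside ∷ []
  dom : Dominating P4 S
  dom 0F = inj₂ (1F , there here , inj₂ (here refl))
  dom 1F = inj₁ (there here)
  dom 2F = inj₁ (there (there here))
  dom 3F = inj₂ (2F , there (there here) , inj₁ (there (there (here refl))))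
  part : ∀ u → u ∈ S → HasPartner P4 S u
  part 1F _ = 2F , there (there here) , (λ ()) , inj₂ (inj₁ (inj₁ (there (here refl))))
  part 2F _ = 1F , there here , (λ ()) , inj₂ (inj₁ (inj₂ (there (here refl))))
  part 3F (there (there (there ())))
  bound : DomLowerBound P4 2
  bound D d = packing D (closedNbhd P4 0F ∷ closedNbhd P4 3F ∷ []) (apart-by-computation _)
    (dominated⇒meets (d 0F) ∷ dominated⇒meets (d 3F) ∷ [])

pendant-core : ∀ {n} {G : Graph n} {v} {S : Subset n} → v ∈ S → Join.Core G K1 v zero S 0
pendant-core v∈S = record
  { set = outside ∷ []
  ; size = refl
  ; dominates = λ { zero → inj₂ (refl , v∈S) }
  ; partnered = λ { zero () }
  }

pendant-cost : AttachmentCost K1 zero 0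
pendant-cost q _ = z≤n , λ a∈q → ≤-trans (s≤s z≤n) (x∈p⇒∣p-x∣<∣p∣ a∈q)

P2-core : ∀ {n} {G : Graph n} {v} {S : Subset n} → Join.Core G P2 v zero S 1
P2-core = record
  { set = inside ∷ outside ∷ []
  ; size = refl
  ; dominates = λ { 0F → inj₁ (inj₁ here) ; 1F → inj₁ (inj₂ (0F , here , inj₁ (here refl))) }
  ; partnered = λ { 0F _ → inj₂ refl ; 1F (there ()) }
  }

P2-bound : AlmostDomBound P2 zero 1
P2-bound q almost = packing q (closedNbhd P2 1F ∷ []) (apart-by-computation _)
  (dominated⇒meets (almost 1F (λ ())) ∷ [])

P5-core : ∀ {n} {G : Graph n} {v} {S : Subset n} → Join.Core G P5 v zero S 2
P5-core = record
  { set = outside ∷ inside ∷ outside ∷ inside ∷ outside ∷ []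
  ; size = refl
  ; dominates = λ
    { 0F → inj₁ (inj₂ (1F , ∈1 , inj₂ (here refl)))
    ; 1F → inj₁ (inj₁ ∈1)
    ; 2F → inj₁ (inj₂ (1F , ∈1 , inj₁ (there (here refl))))
    ; 3F → inj₁ (inj₁ ∈3)
    ; 4F → inj₁ (inj₂ (3F , ∈3 , inj₁ (there (there (there (here refl))))))
    }
  ; partnered = λ
    { 1F _ → inj₁ (3F , ∈3 , (λ ()) , inj₂ (inj₂ (2F , inj₁ (there (here refl)) , inj₁ (there (there (here refl))))))
    ; 3F _ → inj₁ (1F , ∈1 , (λ ()) , inj₂ (inj₂ (2F , inj₂ (there (there (here refl))) , inj₂ (there (here refl)))))
    ; 0F ()
    ; 2F (there (there ()))
    ; 4F (there (there (there (there ()))))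
    }
  }
  where
  ∈1 : 1F ∈ outside ∷ inside ∷ outside ∷ inside ∷ outside ∷ []
  ∈1 = there here
  ∈3 : 3F ∈ outside ∷ inside ∷ outside ∷ inside ∷ outside ∷ []
  ∈3 = there (there (there here))

P5-bound : AlmostDomBound P5 zero 2
P5-bound q almost = packing q (closedNbhd P5 1F ∷ closedNbhd P5 4F ∷ []) (apart-by-computation _)
  (dominated⇒meets (almost 1F (λ ())) ∷ dominated⇒meets (almost 4F (λ ())) ∷ [])

-- 𝒪₄ with Y attached at the leaf-neighbour 1: core {0, 3}; kind A with
-- c = 2, the closed neighbourhoods of 2 and 4 (and {1}) being disjoint.
Y-core : ∀ {n} {G : Graph n} {v} {S : Subset n} → Join.Core G Y v yLeafNbr S 2
Y-core = record
  { set = inside ∷ outside ∷ outside ∷ inside ∷ outside ∷ []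
  ; size = refl
  ; dominates = λ
    { 0F → inj₁ (inj₁ ∈0)
    ; 1F → inj₁ (inj₂ (0F , ∈0 , inj₁ (here refl)))
    ; 2F → inj₁ (inj₂ (0F , ∈0 , inj₁ (there (here refl))))
    ; 3F → inj₁ (inj₁ ∈3)
    ; 4F → inj₁ (inj₂ (3F , ∈3 , inj₁ (there (there (there (here refl))))))
    }
  ; partnered = λ
    { 0F _ → inj₁ (3F , ∈3 , (λ ()) , inj₂ (inj₁ (inj₁ (there (there (here refl))))))
    ; 3F _ → inj₁ (0F , ∈0 , (λ ()) , inj₂ (inj₁ (inj₂ (there (there (here refl))))))
    ; 1F (there ())
    ; 2F (there (there ()))
    ; 4F (there (there (there (there ()))))
    }
  }
  where
  ∈0 : 0F ∈ inside ∷ outside ∷ outside ∷ inside ∷ outside ∷ []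
  ∈0 = here
  ∈3 : 3F ∈ inside ∷ outside ∷ outside ∷ inside ∷ outside ∷ []
  ∈3 = there (there (there here))

Y-cost : AttachmentCost Y yLeafNbr 2
Y-cost q almost =
  packing q (N2 ∷ N4 ∷ []) (apart-by-computation _) (meets2 ∷ meets4 ∷ []) ,
  λ a∈q → packing q ([ 1F ] ∷ N2 ∷ N4 ∷ []) (apart-by-computation _) (here a∈q ∷ meets2 ∷ meets4 ∷ [])
  where
  N2 = closedNbhd Y 2F
  N4 = closedNbhd Y 4F
  meets2 = dominated⇒meets (almost 2F (λ ()))
  meets4 = dominated⇒meets (almost 4F (λ ()))

module Star (t : ℕ) where
  sub leaf : Fin t → Fin (suc (t + t))
  sub i = suc (i ↑ˡ t)
  leaf i = suc (t ↑ʳ i)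

  spokes : Fin t → List (Fin (suc (t + t)) × Fin (suc (t + t)))
  spokes i = (zero , sub i) ∷ (sub i , leaf i) ∷ []

  star-edge⁺ : ∀ i → (zero , sub i) ∈ₗ edges (SubdividedStar t) × (sub i , leaf i) ∈ₗ edges (SubdividedStar t)
  star-edge⁺ i = ∈-concatMap⁺ spokes {allFin t} (lose (∈-allFin i) (here refl)) , ∈-concatMap⁺ spokes {allFin t} (lose (∈-allFin i) (there (here refl)))

  star-edge⁻ : ∀ {e} → e ∈ₗ edges (SubdividedStar t) → ∃[ i ] (e ≡ (zero , sub i) ⊎ e ≡ (sub i , leaf i))
  star-edge⁻ e with find (∈-concatMap⁻ spokes {allFin t} e)
  ... | i , _ , here eq = i , inj₁ eq
  ... | i , _ , there (here eq) = i , inj₂ eq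

  leaf-nbr : ∀ {u} i → Adj (SubdividedStar t) u (leaf i) → u ≡ sub i
  leaf-nbr i (inj₁ e) with star-edge⁻ e
  ... | j , inj₁ eq = ⊥-elim (↑ˡ≢↑ʳ j i (sym (suc-injective (cong proj₂ eq))))
  ... | j , inj₂ eq = trans (cong proj₁ eq) (cong sub (sym (↑ʳ-injective t i j (suc-injective (cong proj₂ eq)))))
  leaf-nbr i (inj₂ e) with star-edge⁻ e
  ... | j , inj₁ eq with cong proj₁ eq
  ...   | ()
  leaf-nbr i (inj₂ e) | j , inj₂ eq = ⊥-elim (↑ˡ≢↑ʳ j i (sym (suc-injective (cong proj₁ eq))))

  -- leaf i forces sub i or leaf i into an almost dominating set, and these
  -- pairs are disjoint; containing the center costs one more
  star-cost : AttachmentCost (SubdividedStar t) zero t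
  star-cost (b ∷ r) almost with split t t r
  ... | subs ⊕ leaves = ≤-trans covered (∣p∣≤∣x∷p∣ b (subs ++ leaves)) , with-center
    where
    cover : ∀ i → i ∈ subs ⊎ i ∈ leaves
    cover i with almost (leaf i) (λ ())
    ... | inj₁ (there i∈) = inj₂ (∈ʳ⁻ subs i i∈)
    ... | inj₂ (u , u∈ , adj) with subst (_∈ b ∷ (subs ++ leaves)) (leaf-nbr i adj) u∈
    ...   | there i∈ = inj₁ (∈ˡ⁻ subs i i∈)
    covered : t ≤ ∣ subs ++ leaves ∣
    covered = subst (t ≤_) (sym (∣p++q∣ subs leaves)) (covering-bound subs leaves cover)
    with-center : zero ∈ b ∷ (subs ++ leaves) → suc t ≤ ∣ b ∷ (subs ++ leaves) ∣
    with-center here = s≤s covered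

  subs-set : Subset (suc (t + t))
  subs-set = outside ∷ (⊤ {t} ++ ⊥ {t})

  sub∈ : ∀ i → sub i ∈ subs-set
  sub∈ i = there (∈ˡ⁺ ∈⊤)

  leaf∉ : ∀ i → ¬ (leaf i ∈ subs-set)
  leaf∉ i (there i∈) = ∉⊥ (∈ʳ⁻ (⊤ {t}) i i∈)

  subs-size : ∣ subs-set ∣ ≡ t
  subs-size = trans (∣p++q∣ (⊤ {t}) (⊥ {t})) (trans (cong (_+ ∣ ⊥ {t} ∣) (∣⊤∣≡n t)) (trans (cong (t +_) (∣⊥∣≡0 t)) (+-identityʳ t)))

-- With at least two leaves, two subdivision vertices are partners through the center.
star-core : ∀ t' {n} {G : Graph n} {v} {S : Subset n} → Join.Core G (SubdividedStar (suc (suc t'))) v zero S (suc (suc t'))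
star-core t' = record
  { set = subs-set
  ; size = subs-size
  ; dominates = dominates
  ; partnered = partnered
  }
  where
  t : ℕ
  t = suc (suc t')
  open Star t

  other : Fin t → Fin t
  other zero = suc zero
  other (suc _) = zero

  other≢ : ∀ i → i ≢ other i
  other≢ zero ()
  other≢ (suc _) ()

  dominates : ∀ y → DominatedBy (SubdividedStar _) subs-set y ⊎ _
  dominates zero = inj₁ (inj₂ (sub zero , sub∈ zero , inj₂ (proj₁ (star-edge⁺ zero))))
  dominates (suc r) with side t t r
  ... | left i = inj₁ (inj₁ (sub∈ i))
  ... | right i = inj₁ (inj₂ (sub i , sub∈ i , inj₁ (proj₂ (star-edge⁺ i))))

  partnered : ∀ y → y ∈ subs-set → HasPartner (SubdividedStar _) subs-set y ⊎ _
  partnered (suc r) r∈ with side t t r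
  ... | left i = inj₁ (sub (other i) , sub∈ (other i) ,
          (λ e → other≢ i (↑ˡ-injective _ i (other i) (suc-injective e))) ,
          inj₂ (inj₂ (zero , inj₂ (proj₁ (star-edge⁺ i)) , inj₁ (proj₁ (star-edge⁺ (other i))))))
  ... | right i = ⊥-elim (leaf∉ i r∈)

tight : ∀ {n} {T : Graph n} → InO T → ∃[ k ] Tight T k
tight base = 2 , tight-P4
tight (op1 {T = T} o v (S , γt2-set , v∈S)) with tight o
... | k , t = k + 0 , Join.upper T K1 v zero (S , proj₁ γt2-set , γt2-set-size t γt2-set) (pendant-core v∈S)
                    , Join.lowerᴬ T K1 v zero (proj₂ t) pendant-cost
tight (op2-P2 {T = T} o v γ≡γv) with tight o
... | k , t = k + 1 , Join.upper T P2 v zero (proj₁ t) P2-core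
                    , Join.lowerᴮ T P2 v zero (almost-bound t γ≡γv) P2-bound
tight (op2-P5 {T = T} o v γ≡γv) with tight o
... | k , t = k + 2 , Join.upper T P5 v zero (proj₁ t) P5-core
                    , Join.lowerᴮ T P5 v zero (almost-bound t γ≡γv) P5-bound
tight (op3 {T = T} o v .(suc (suc t')) (s≤s (s≤s {n = t'} _))) with tight o
... | k , t = k + suc (suc t') , Join.upper T _ v zero (proj₁ t) (star-core t')
                               , Join.lowerᴬ T _ v zero (proj₂ t) (Star.star-cost (suc (suc t')))
tight (op4 {T = T} o v) with tight o
... | k , t = k + 2 , Join.upper T Y v yLeafNbr (proj₁ t) Y-core
                    , Join.lowerᴬ T Y v yLeafNbr (proj₂ t) Y-cost

lemma3p1 : ∀ {n} (T : Graph n) → InO T →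
    ∃[ k ] (IsDomNum T k × IsSemitotalDomNum T k)
lemma3p1 T o with tight o
... | k , t = k , tight⇒γ≡γt2 t
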